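{- Let $A\subseteq G=\mathbb{F}_2^n$ have coset complexity at most $\ell$. Then there exist $t\le 3^\ell$, cosets $W_1+a_1,\dots,W_t+a_t$ of subgroups of $G$, and signs $\epsilon_1,\dots,\epsilon_t\in\{ -1,1\}$ such that $\mathbf{1}_A=\sum_{i=1}^t\epsilon_i\mathbf{1}_{W_i+a_i}$. In particular, $\|\mathbf{1}_A\|_A\le 3^\ell$.
   Context: $G=\mathbb{F}_2^n$. For $f:G\to\mathbb{R}$, $\widehat f(a)=\mathbb{E}_{x\in G}[f(x)(-1)^{a^tx}]$ and $\|f\|_A=\sum_{a\in G}|\widehat f(a)|$. $\mathbf{1}_S$ denotes the indicator function of $S$. A coset is a coset of a subgroup of $G$. A set $A\subseteq G$ has coset complexity at most $\ell$ if it belongs to the ring of sets (family of subsets of $G$ containing $G$ and closed under complements, finite unions and finite intersections) generated by at most $\ell$ cosets. -}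

module Defs where

open import Data.Bool using (Bool; true; false; _xor_; _∧_; if_then_else_)
open import Data.Nat as ℕ using (ℕ; zero; suc)
open import Data.Fin using (Fin; zero; suc)
open import Data.Vec using (Vec; []; _∷_; zipWith; replicate; foldr)
open import Data.List using (List; []; _∷_; map; _++_)
open import Data.Integer as ℤ using (ℤ)
open import Data.Rational as ℚ using (ℚ; 0ℚ; 1ℚ; ½)
open import Data.Product using (Σ; _×_; _,_)
open import Relation.Binary.PropositionalEquality using (_≡_)

G : ℕ → Set
G n = Vec Bool n

_⊕_ : ∀ {n} → G n → G n → G n
_⊕_ = zipWith _xor_

0G : ∀ n → G n
0G n = replicate n false

dot : ∀ {n} → G n → G n → Bool
dot a x = foldr _ _xor_ false (zipWith _∧_ a x)

Subset : ℕ → Set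
Subset n = G n → Bool

-- W is a subgroup of G = F₂ⁿ (contains 0, closed under addition;
-- inverses are automatic since x + x = 0).
IsSubgroup : ∀ {n} → Subset n → Set
IsSubgroup {n} W =
  (W (0G n) ≡ true) × (∀ x y → W x ≡ true → W y ≡ true → W (x ⊕ y) ≡ true)

-- The coset W + a, as a subset: x ∈ W + a  iff  x - a = x + a ∈ W.
cosetOf : ∀ {n} → Subset n → G n → Subset n
cosetOf W a x = W (x ⊕ a)

IsCoset : ∀ {n} → Subset n → Set
IsCoset {n} S = Σ (Subset n) λ W → Σ (G n) λ a →
  IsSubgroup W × (∀ x → S x ≡ cosetOf W a x)

data SetExpr (ℓ : ℕ) : Set where
  whole : SetExpr ℓ
  gen   : Fin ℓ → SetExpr ℓ
  compl : SetExpr ℓ → SetExpr ℓ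
  union : SetExpr ℓ → SetExpr ℓ → SetExpr ℓ
  inter : SetExpr ℓ → SetExpr ℓ → SetExpr ℓ

not' : Bool → Bool
not' true = false
not' false = true

_∨'_ : Bool → Bool → Bool
true ∨' _ = true
false ∨' b = b

evalExpr : ∀ {n ℓ} → (Fin ℓ → Subset n) → SetExpr ℓ → Subset n
evalExpr C whole x = true
evalExpr C (gen i) x = C i x
evalExpr C (compl e) x = not' (evalExpr C e x)
evalExpr C (union e f) x = evalExpr C e x ∨' evalExpr C f x
evalExpr C (inter e f) x = evalExpr C e x ∧ evalExpr C f x

-- A has coset complexity at most ℓ: A lies in the ring of sets generated by
-- (a family of) ℓ cosets C₀,…,C_{ℓ-1} (repetitions allowed, so "at most ℓ").
CosetComplexityAtMost : ∀ {n} → ℕ → Subset n → Set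
CosetComplexityAtMost {n} ℓ A =
  Σ (Fin ℓ → Subset n) λ C → (∀ i → IsCoset (C i)) ×
  Σ (SetExpr ℓ) λ e → ∀ x → A x ≡ evalExpr C e x

𝟙ℤ : ∀ {n} → Subset n → G n → ℤ
𝟙ℤ S x = if S x then ℤ.+ 1 else ℤ.+ 0

𝟙ℚ : ∀ {n} → Subset n → G n → ℚ
𝟙ℚ S x = if S x then 1ℚ else 0ℚ

sumFinℤ : ∀ {t} → (Fin t → ℤ) → ℤ
sumFinℤ {zero} f = ℤ.+ 0
sumFinℤ {suc t} f = f zero ℤ.+ sumFinℤ (λ i → f (suc i))

allG : ∀ n → List (G n)
allG zero = [] ∷ []
allG (suc n) = map (false ∷_) (allG n) ++ map (true ∷_) (allG n)

sumGℚ : ∀ {n} → (G n → ℚ) → ℚ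
sumGℚ {n} f = Data.List.foldr (λ x acc → f x ℚ.+ acc) 0ℚ (allG n)

halfPow : ℕ → ℚ
halfPow zero = 1ℚ
halfPow (suc n) = ½ ℚ.* halfPow n

signOf : Bool → ℚ
signOf false = 1ℚ
signOf true = ℚ.- 1ℚ

fourier : ∀ {n} → (G n → ℚ) → G n → ℚ
fourier {n} f a = halfPow n ℚ.* sumGℚ (λ x → f x ℚ.* signOf (dot a x))

algNorm : ∀ {n} → (G n → ℚ) → ℚ
algNorm f = sumGℚ (λ a → ℚ.∣ fourier f a ∣)

{-# OPTIONS --safe #-}
module Submission where

-- Write A as a Boolean function f of the memberships in cosets C₁, …, C_ℓ. Expanding along C = C₁,
--   1_{f(c,v)} = 1_C · 1_{f(1,v)} + 1_{f(0,v)} − 1_C · 1_{f(0,v)},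
-- turns signed coset sums of at most N terms for f(1,·) and f(0,·) into one of at most 3N terms for f,
-- since multiplying by 1_C replaces a coset D by C ∩ D, which is empty or again a coset. Hence 1_A is
-- a signed sum of at most 3^ℓ coset indicators. The Fourier coefficient of 1_{W+a} at b is
-- 2⁻ⁿ (-1)^{b·a} Σ_{y∈W} (-1)^{b·y}, and these character sums are non-negative with total 2ⁿ, so
-- ‖1_{W+a}‖_A = 1 and the triangle inequality bounds ‖1_A‖_A by the number of terms.

open import Defs

open import Algebra.Bundles using (CommutativeRing)
import Algebra.Properties.CommutativeSemigroup as CommutativeSemigroupProperties
import Algebra.Properties.Ring as RingProperties
open import Data.Bool using (Bool; true; false; not; _xor_; _∧_; if_then_else_)
open import Data.Bool.Properties
  using (xor-assoc; xor-same; xor-identityʳ; ∧-distribˡ-xor; xor-∧-commutativeRing; ∧-conicalˡ; ∧-conicalʳ; ⇔→≡)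
open import Data.Fin using (Fin; zero; suc)
import Data.Integer as ℤ
import Data.Integer.Properties as ℤP
open import Data.List as List using (List; []; _∷_; _++_; length; foldr; mapMaybe)
open import Data.List.Properties using (length-++; length-map; length-mapMaybe)
open import Data.Maybe as Maybe using (Maybe; just; nothing; maybe′)
open import Data.Nat as ℕ using (ℕ; zero; suc; _≤_; _^_; z≤n; s≤s)
import Data.Nat.Coprimality as Coprime
import Data.Nat.Properties as ℕP
open import Data.Product using (Σ; _×_; _,_; proj₁; proj₂; ∃-syntax; map₁)
open import Data.Rational as Q using (ℚ)
import Data.Rational.Properties as ℚP
open import Data.Sign as Sign using (Sign; opposite)
open import Data.Sum using (_⊎_; inj₁; inj₂)
open import Data.Vec using (Vec; []; _∷_; tabulate; lookup)
open import Data.Vec.Properties using (lookup∘tabulate; tabulate-cong)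
open import Function.Bundles using (mk⇔)
open import Relation.Binary.PropositionalEquality using (_≡_; refl; sym; trans; cong; cong₂; subst; module ≡-Reasoning)

⊕-assoc : ∀ {n} (x y z : G n) → (x ⊕ y) ⊕ z ≡ x ⊕ (y ⊕ z)
⊕-assoc []       []       []       = refl
⊕-assoc (x ∷ xs) (y ∷ ys) (z ∷ zs) = cong₂ _∷_ (xor-assoc x y z) (⊕-assoc xs ys zs)

⊕-cancelʳ : ∀ {n} (x y : G n) → (x ⊕ y) ⊕ y ≡ x
⊕-cancelʳ []       []       = refl
⊕-cancelʳ (x ∷ xs) (y ∷ ys) = cong₂ _∷_ xor-cancelʳ (⊕-cancelʳ xs ys)
  where
  xor-cancelʳ : (x xor y) xor y ≡ x
  xor-cancelʳ = trans (xor-assoc x y y) (trans (cong (x xor_) (xor-same y)) (xor-identityʳ x))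

dot-distribˡ-⊕ : ∀ {n} (b x y : G n) → dot b (x ⊕ y) ≡ dot b x xor dot b y
dot-distribˡ-⊕ []       []       []       = refl
dot-distribˡ-⊕ (b ∷ bs) (x ∷ xs) (y ∷ ys) = begin
  (b ∧ (x xor y)) xor dot bs (xs ⊕ ys)
    ≡⟨ cong₂ _xor_ (∧-distribˡ-xor b x y) (dot-distribˡ-⊕ bs xs ys) ⟩
  ((b ∧ x) xor (b ∧ y)) xor (dot bs xs xor dot bs ys)
    ≡⟨ interchange (b ∧ x) (b ∧ y) (dot bs xs) (dot bs ys) ⟩
  ((b ∧ x) xor dot bs xs) xor ((b ∧ y) xor dot bs ys) ∎
  where
  open ≡-Reasoning
  open CommutativeSemigroupProperties
    (CommutativeRing.+-commutativeSemigroup xor-∧-commutativeRing) using (interchange)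

search : ∀ {n} (P : G n → Bool) → (∃[ x ] P x ≡ true) ⊎ (∀ x → P x ≡ false)
search {zero} P with P [] in P[]
... | true  = inj₁ ([] , P[])
... | false = inj₂ λ { [] → P[] }
search {suc n} P with search (λ x → P (false ∷ x)) | search (λ x → P (true ∷ x))
... | inj₁ (x , Px) | _             = inj₁ (false ∷ x , Px)
... | inj₂ _        | inj₁ (x , Px) = inj₁ (true ∷ x , Px)
... | inj₂ none₀    | inj₂ none₁    = inj₂ λ { (false ∷ x) → none₀ x ; (true ∷ x) → none₁ x }

module _ {n : ℕ} {W : Subset n} (W-subgroup : IsSubgroup W) where

  subgroup-translate : ∀ {w} → W w ≡ true → ∀ x → W (x ⊕ w) ≡ W x
  subgroup-translate {w} w∈W x = ⇔→≡ (mk⇔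
    (λ x+w∈W → subst (λ y → W y ≡ true) (⊕-cancelʳ x w) (proj₂ W-subgroup _ _ x+w∈W w∈W))
    (λ x∈W → proj₂ W-subgroup _ _ x∈W w∈W))

  coset-rebase : ∀ {a c} → cosetOf W a c ≡ true → ∀ x → cosetOf W c x ≡ cosetOf W a x
  coset-rebase {a} {c} c∈W+a x = begin
    W (x ⊕ c)               ≡⟨ subgroup-translate c∈W+a (x ⊕ c) ⟨
    W ((x ⊕ c) ⊕ (c ⊕ a))   ≡⟨ cong W (⊕-assoc (x ⊕ c) c a) ⟨
    W (((x ⊕ c) ⊕ c) ⊕ a)   ≡⟨ cong (λ y → W (y ⊕ a)) (⊕-cancelʳ x c) ⟩
    W (x ⊕ a)               ∎
    where open ≡-Reasoning

∧-isSubgroup : ∀ {n} {W V : Subset n} → IsSubgroup W → IsSubgroup V → IsSubgroup (λ x → W x ∧ V x)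
∧-isSubgroup (0∈W , W-closed) (0∈V , V-closed) = cong₂ _∧_ 0∈W 0∈V , λ x y x∈ y∈ →
  cong₂ _∧_ (W-closed x y (∧-conicalˡ _ _ x∈) (∧-conicalˡ _ _ y∈))
            (V-closed x y (∧-conicalʳ _ _ x∈) (∧-conicalʳ _ _ y∈))

record Coset (n : ℕ) : Set where
  field
    subgroup   : Subset n
    base       : G n
    isSubgroup : IsSubgroup subgroup

  members : Subset n
  members = cosetOf subgroup base

open Coset

wholeSpace : ∀ {n} → Coset n
wholeSpace {n} = record { subgroup = λ _ → true ; base = 0G n ; isSubgroup = refl , λ _ _ _ _ → refl }

_∩_ : ∀ {n} → Coset n → Coset n → Maybe (Coset n)
C ∩ D with search (λ x → members C x ∧ members D x)
... | inj₁ (c , _) = just record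
  { subgroup   = λ x → subgroup C x ∧ subgroup D x
  ; base       = c
  ; isSubgroup = ∧-isSubgroup (isSubgroup C) (isSubgroup D)
  }
... | inj₂ _ = nothing

members-∩ : ∀ {n} (C D : Coset n) x →
            (members C x ∧ members D x) ≡ maybe′ (λ E → members E x) false (C ∩ D)
members-∩ C D x with search (λ x → members C x ∧ members D x)
... | inj₁ (c , c∈C∩D) = sym (cong₂ _∧_
  (coset-rebase (isSubgroup C) (∧-conicalˡ _ _ c∈C∩D) x)
  (coset-rebase (isSubgroup D) (∧-conicalʳ _ _ c∈C∩D) x))
... | inj₂ C∩D≡∅ = C∩D≡∅ x

SignedCosets : ℕ → Set
SignedCosets n = List (Sign × Coset n)

restrict : ∀ {n} → Coset n → SignedCosets n → SignedCosets n
restrict C = mapMaybe (λ (s , D) → Maybe.map (s ,_) (C ∩ D))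

negate : ∀ {n} → SignedCosets n → SignedCosets n
negate = List.map (map₁ opposite)

decompose : ∀ {n ℓ} → (Fin ℓ → Coset n) → (Vec Bool ℓ → Bool) → SignedCosets n
decompose {ℓ = zero}  Cs f = if f [] then (Sign.+ , wholeSpace) ∷ [] else []
decompose {ℓ = suc ℓ} Cs f = restrict (Cs zero) D₁ ++ D₀ ++ negate (restrict (Cs zero) D₀)
  where
  D₀ = decompose (λ i → Cs (suc i)) (λ v → f (false ∷ v))
  D₁ = decompose (λ i → Cs (suc i)) (λ v → f (true ∷ v))

decompose-length : ∀ {n ℓ} (Cs : Fin ℓ → Coset n) f → length (decompose Cs f) ≤ 3 ^ ℓ
decompose-length {ℓ = zero}  Cs f with f []
... | true  = s≤s z≤n
... | false = z≤n
decompose-length {ℓ = suc ℓ} Cs f = begin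
  length (R₁ ++ D₀ ++ negate R₀)                 ≡⟨ length-++ R₁ ⟩
  length R₁ ℕ.+ length (D₀ ++ negate R₀)         ≡⟨ cong (length R₁ ℕ.+_) (length-++ D₀) ⟩
  length R₁ ℕ.+ (length D₀ ℕ.+ length (negate R₀))
    ≡⟨ cong (λ k → length R₁ ℕ.+ (length D₀ ℕ.+ k)) (length-map (map₁ opposite) R₀) ⟩
  length R₁ ℕ.+ (length D₀ ℕ.+ length R₀)
    ≤⟨ ℕP.+-mono-≤ (restricted D₁ (decompose-length Cs′ _))
         (ℕP.+-mono-≤ (decompose-length Cs′ _) (restricted D₀ (decompose-length Cs′ _))) ⟩
  3 ^ ℓ ℕ.+ (3 ^ ℓ ℕ.+ 3 ^ ℓ)
    ≡⟨ cong (λ k → 3 ^ ℓ ℕ.+ (3 ^ ℓ ℕ.+ k)) (ℕP.+-identityʳ (3 ^ ℓ)) ⟨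
  3 ^ suc ℓ                                      ∎
  where
  open ℕP.≤-Reasoning
  Cs′ = λ i → Cs (suc i)
  D₀ = decompose Cs′ (λ v → f (false ∷ v))
  D₁ = decompose Cs′ (λ v → f (true ∷ v))
  R₀ = restrict (Cs zero) D₀
  R₁ = restrict (Cs zero) D₁
  restricted : ∀ ts → length ts ≤ 3 ^ ℓ → length (restrict (Cs zero) ts) ≤ 3 ^ ℓ
  restricted ts = ℕP.≤-trans (length-mapMaybe _ ts)

module ListSum {r₁ r₂} (R : CommutativeRing r₁ r₂) where

  open CommutativeRing R renaming (refl to ≈-refl; sym to ≈-sym; trans to ≈-trans) hiding (zero)
  open import Relation.Binary.Reasoning.Setoid setoid
  open RingProperties ring using (-0#≈0#; -‿+-comm)
  open CommutativeSemigroupProperties +-commutativeSemigroup using (interchange)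

  ∑ : {A : Set} → List A → (A → Carrier) → Carrier
  ∑ xs f = foldr (λ x acc → f x + acc) 0# xs

  module _ {A : Set} where

    ∑-cong : ∀ (xs : List A) {f g} → (∀ x → f x ≈ g x) → ∑ xs f ≈ ∑ xs g
    ∑-cong []       f≈g = ≈-refl
    ∑-cong (x ∷ xs) f≈g = +-cong (f≈g x) (∑-cong xs f≈g)

    ∑-++ : ∀ (xs ys : List A) f → ∑ (xs ++ ys) f ≈ ∑ xs f + ∑ ys f
    ∑-++ []       ys f = ≈-sym (+-identityˡ _)
    ∑-++ (x ∷ xs) ys f = ≈-trans (+-congˡ (∑-++ xs ys f)) (≈-sym (+-assoc _ _ _))

    ∑-map : ∀ {B : Set} (h : A → B) xs f → ∑ (List.map h xs) f ≡ ∑ xs (λ x → f (h x))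
    ∑-map h []       f = refl
    ∑-map h (x ∷ xs) f = cong (_+_ (f (h x))) (∑-map h xs f)

    ∑-zero : ∀ (xs : List A) → ∑ xs (λ _ → 0#) ≈ 0#
    ∑-zero []       = ≈-refl
    ∑-zero (x ∷ xs) = ≈-trans (+-identityˡ _) (∑-zero xs)

    ∑-+ : ∀ (xs : List A) f g → ∑ xs (λ x → f x + g x) ≈ ∑ xs f + ∑ xs g
    ∑-+ []       f g = ≈-sym (+-identityˡ 0#)
    ∑-+ (x ∷ xs) f g = ≈-trans (+-congˡ (∑-+ xs f g)) (interchange _ _ _ _)

    ∑-*ˡ : ∀ (xs : List A) c f → ∑ xs (λ x → c * f x) ≈ c * ∑ xs f
    ∑-*ˡ []       c f = ≈-sym (zeroʳ c)
    ∑-*ˡ (x ∷ xs) c f = ≈-trans (+-congˡ (∑-*ˡ xs c f)) (≈-sym (distribˡ c _ _))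

    ∑-*ʳ : ∀ (xs : List A) c f → ∑ xs (λ x → f x * c) ≈ ∑ xs f * c
    ∑-*ʳ xs c f = ≈-trans (∑-cong xs (λ x → *-comm (f x) c)) (≈-trans (∑-*ˡ xs c f) (*-comm c _))

    ∑-neg : ∀ (xs : List A) f → ∑ xs (λ x → - f x) ≈ - ∑ xs f
    ∑-neg []       f = ≈-sym -0#≈0#
    ∑-neg (x ∷ xs) f = ≈-trans (+-congˡ (∑-neg xs f)) (-‿+-comm _ _)

  ∑-comm : ∀ {A B : Set} (xs : List A) (ys : List B) (F : A → B → Carrier) →
           ∑ xs (λ x → ∑ ys (F x)) ≈ ∑ ys (λ y → ∑ xs (λ x → F x y))
  ∑-comm []       ys F = ≈-sym (∑-zero ys)
  ∑-comm (x ∷ xs) ys F = ≈-trans (+-congˡ (∑-comm xs ys F)) (≈-sym (∑-+ ys (F x) _))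

-- Signed coset sums are evaluated in any commutative ring: in ℤ for the identity of the theorem
-- and in ℚ for the Fourier bound.
module SignedSums {r₁ r₂} (R : CommutativeRing r₁ r₂) where

  open CommutativeRing R renaming (refl to ≈-refl; sym to ≈-sym; trans to ≈-trans) hiding (zero)
  open import Relation.Binary.Reasoning.Setoid setoid
  open RingProperties ring using (-0#≈0#; -‿involutive; -‿distribˡ-*; x≈y⇒x∙y⁻¹≈ε)
  open CommutativeSemigroupProperties *-commutativeSemigroup using (x∙yz≈y∙xz)
  open ListSum R public

  ind : Bool → Carrier
  ind b = if b then 1# else 0#

  ⟦_⟧ : Sign → Carrier
  ⟦ Sign.+ ⟧ = 1#
  ⟦ Sign.- ⟧ = - 1#

  signedIndicator : ∀ {n} → Sign × Coset n → G n → Carrier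
  signedIndicator (s , C) x = ⟦ s ⟧ * ind (members C x)

  signedSum : ∀ {n} → SignedCosets n → G n → Carrier
  signedSum ts x = ∑ ts (λ t → signedIndicator t x)

  ind-∧ : ∀ p q → ind (p ∧ q) ≈ ind p * ind q
  ind-∧ true  q = ≈-sym (*-identityˡ _)
  ind-∧ false q = ≈-sym (zeroˡ _)

  ⟦opposite⟧ : ∀ s → ⟦ opposite s ⟧ ≈ - ⟦ s ⟧
  ⟦opposite⟧ Sign.- = ≈-sym (-‿involutive 1#)
  ⟦opposite⟧ Sign.+ = ≈-refl

  ind-shannon : ∀ (F : Bool → Bool) c →
                ind (F c) ≈ ind c * ind (F true) + (ind (F false) - ind c * ind (F false))
  ind-shannon F true = ≈-sym (begin
    1# * a + (b - 1# * b) ≈⟨ +-cong (*-identityˡ a) (x≈y⇒x∙y⁻¹≈ε (≈-sym (*-identityˡ b))) ⟩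
    a + 0#                ≈⟨ +-identityʳ a ⟩
    a                     ∎)
    where a = ind (F true); b = ind (F false)
  ind-shannon F false = ≈-sym (begin
    0# * a + (b - 0# * b) ≈⟨ +-cong (zeroˡ a) (+-congˡ (-‿cong (zeroˡ b))) ⟩
    0# + (b - 0#)         ≈⟨ +-identityˡ _ ⟩
    b - 0#                ≈⟨ +-congˡ -0#≈0# ⟩
    b + 0#                ≈⟨ +-identityʳ b ⟩
    b                     ∎)
    where a = ind (F true); b = ind (F false)

  module _ {n : ℕ} (x : G n) where

    signedSum-++ : ∀ ts us → signedSum (ts ++ us) x ≈ signedSum ts x + signedSum us x
    signedSum-++ ts us = ∑-++ ts us _

    signedSum-negate : ∀ ts → signedSum (negate ts) x ≈ - signedSum ts x
    signedSum-negate ts = begin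
      signedSum (negate ts) x                              ≡⟨ ∑-map (map₁ opposite) ts _ ⟩
      ∑ ts (λ (s , C) → ⟦ opposite s ⟧ * ind (members C x)) ≈⟨ ∑-cong ts opposite-term ⟩
      ∑ ts (λ t → - signedIndicator t x)                   ≈⟨ ∑-neg ts _ ⟩
      - signedSum ts x                                     ∎
      where
      opposite-term : ∀ ((s , C) : Sign × Coset n) →
                      ⟦ opposite s ⟧ * ind (members C x) ≈ - (⟦ s ⟧ * ind (members C x))
      opposite-term (s , C) = ≈-trans (*-congʳ (⟦opposite⟧ s)) (≈-sym (-‿distribˡ-* _ _))

    signedSum-restrict-∷ : ∀ C s D ts → signedSum (restrict C ((s , D) ∷ ts)) x ≈
                           ⟦ s ⟧ * ind (members C x ∧ members D x) + signedSum (restrict C ts) x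
    signedSum-restrict-∷ C s D ts with C ∩ D | members-∩ C D x
    ... | just E  | C∩D = +-congʳ (*-congˡ (reflexive (cong ind (sym C∩D))))
    ... | nothing | C∩D = ≈-sym (begin
      ⟦ s ⟧ * ind (members C x ∧ members D x) + signedSum (restrict C ts) x
        ≈⟨ +-congʳ (*-congˡ (reflexive (cong ind C∩D))) ⟩
      ⟦ s ⟧ * 0# + signedSum (restrict C ts) x ≈⟨ +-congʳ (zeroʳ _) ⟩
      0# + signedSum (restrict C ts) x         ≈⟨ +-identityˡ _ ⟩
      signedSum (restrict C ts) x              ∎)

    signedSum-restrict : ∀ C ts → signedSum (restrict C ts) x ≈ ind (members C x) * signedSum ts x
    signedSum-restrict C []             = ≈-sym (zeroʳ _)
    signedSum-restrict C ((s , D) ∷ ts) = begin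
      signedSum (restrict C ((s , D) ∷ ts)) x
        ≈⟨ signedSum-restrict-∷ C s D ts ⟩
      ⟦ s ⟧ * ind (c ∧ d) + signedSum (restrict C ts) x
        ≈⟨ +-cong (*-congˡ (ind-∧ c d)) (signedSum-restrict C ts) ⟩
      ⟦ s ⟧ * (ind c * ind d) + ind c * signedSum ts x
        ≈⟨ +-congʳ (x∙yz≈y∙xz _ _ _) ⟩
      ind c * (⟦ s ⟧ * ind d) + ind c * signedSum ts x
        ≈⟨ distribˡ _ _ _ ⟨
      ind c * (⟦ s ⟧ * ind d + signedSum ts x) ∎
      where c = members C x; d = members D x

  decompose-signedSum : ∀ {n ℓ} (Cs : Fin ℓ → Coset n) f x →
                        ind (f (tabulate (λ i → members (Cs i) x))) ≈ signedSum (decompose Cs f) x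
  decompose-signedSum {ℓ = zero}  Cs f x with f []
  ... | true  = ≈-sym (≈-trans (+-identityʳ _) (*-identityˡ 1#))
  ... | false = ≈-refl
  decompose-signedSum {ℓ = suc ℓ} Cs f x = begin
    ind (f (c ∷ v))
      ≈⟨ ind-shannon (λ b → f (b ∷ v)) c ⟩
    ind c * ind (f (true ∷ v)) + (ind (f (false ∷ v)) - ind c * ind (f (false ∷ v)))
      ≈⟨ +-cong (*-congˡ (decompose-signedSum Cs′ _ x))
                (+-cong (decompose-signedSum Cs′ _ x) (-‿cong (*-congˡ (decompose-signedSum Cs′ _ x)))) ⟩
    ind c * signedSum D₁ x + (signedSum D₀ x - ind c * signedSum D₀ x)
      ≈⟨ +-cong (signedSum-restrict x C D₁) (+-congˡ (-‿cong (signedSum-restrict x C D₀))) ⟨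
    signedSum R₁ x + (signedSum D₀ x - signedSum R₀ x)
      ≈⟨ +-congˡ (+-congˡ (signedSum-negate x R₀)) ⟨
    signedSum R₁ x + (signedSum D₀ x + signedSum (negate R₀) x)
      ≈⟨ +-congˡ (signedSum-++ x D₀ (negate R₀)) ⟨
    signedSum R₁ x + signedSum (D₀ ++ negate R₀) x
      ≈⟨ signedSum-++ x R₁ (D₀ ++ negate R₀) ⟨
    signedSum (R₁ ++ D₀ ++ negate R₀) x ∎
    where
    C = Cs zero
    Cs′ = λ i → Cs (suc i)
    c = members C x
    v = tabulate (λ i → members (Cs′ i) x)
    D₀ = decompose Cs′ (λ u → f (false ∷ u))
    D₁ = decompose Cs′ (λ u → f (true ∷ u))
    R₀ = restrict C D₀
    R₁ = restrict C D₁

module ℚΣ = SignedSums ℚP.+-*-commutativeRing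
module ℤΣ = SignedSums ℤP.+-*-commutativeRing

module AlgebraNorm where

  open Q using (0ℚ; 1ℚ; ½; _+_; _*_; -_; ∣_∣) renaming (_≤_ to _≤ℚ_)
  open ℚΣ

  ∑-mono-≤ : ∀ {A : Set} (xs : List A) {f g : A → ℚ} → (∀ x → f x ≤ℚ g x) → ∑ xs f ≤ℚ ∑ xs g
  ∑-mono-≤ []       f≤g = ℚP.≤-refl
  ∑-mono-≤ (x ∷ xs) f≤g = ℚP.+-mono-≤ (f≤g x) (∑-mono-≤ xs f≤g)

  ∑-nonneg : ∀ {A : Set} (xs : List A) {f : A → ℚ} → (∀ x → 0ℚ ≤ℚ f x) → 0ℚ ≤ℚ ∑ xs f
  ∑-nonneg xs {f} 0≤f = subst (_≤ℚ ∑ xs f) (∑-zero xs) (∑-mono-≤ xs 0≤f)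

  ∣∑∣≤∑∣∣ : ∀ {A : Set} (xs : List A) (f : A → ℚ) → ∣ ∑ xs f ∣ ≤ℚ ∑ xs (λ x → ∣ f x ∣)
  ∣∑∣≤∑∣∣ []       f = ℚP.≤-refl
  ∣∑∣≤∑∣∣ (x ∷ xs) f =
    ℚP.≤-trans (ℚP.∣p+q∣≤∣p∣+∣q∣ (f x) _) (ℚP.+-monoʳ-≤ ∣ f x ∣ (∣∑∣≤∑∣∣ xs f))

  ∑-ones-≤ : ∀ {A : Set} (xs : List A) {m} → length xs ≤ m → ∑ xs (λ _ → 1ℚ) ≤ℚ ℤ.+ m Q./ 1
  ∑-ones-≤ []       {m}     _           = ℚP.nonNegative⁻¹ _ {{ℚP.normalize-nonNeg m 1}}
  ∑-ones-≤ (x ∷ xs) {suc m} (s≤s xs≤m) =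
    subst (1ℚ + ∑ xs (λ _ → 1ℚ) ≤ℚ_) 1+m/1≡[1+m]/1 (ℚP.+-monoʳ-≤ 1ℚ (∑-ones-≤ xs xs≤m))
    where
    1+m/1≡[1+m]/1 : 1ℚ + ℤ.+ m Q./ 1 ≡ ℤ.+ suc m Q./ 1
    1+m/1≡[1+m]/1 = trans (cong (1ℚ +_) (ℚP.normalize-coprime (Coprime.sym (Coprime.1-coprimeTo m))))
      (ℚP./-cong (cong (ℤ._+_ ℤ.1ℤ) (ℤP.*-identityʳ (ℤ.+ m))) refl)

  χ : ∀ {n} → G n → G n → ℚ
  χ b x = signOf (dot b x)

  signOf-xor : ∀ p q → signOf (p xor q) ≡ signOf p * signOf q
  signOf-xor true  true  = refl
  signOf-xor true  false = refl
  signOf-xor false true  = refl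
  signOf-xor false false = refl

  χ-⊕ : ∀ {n} (b x y : G n) → χ b (x ⊕ y) ≡ χ b x * χ b y
  χ-⊕ b x y = trans (cong signOf (dot-distribˡ-⊕ b x y)) (signOf-xor (dot b x) (dot b y))

  sumG-split : ∀ {n} (f : G (suc n) → ℚ) →
               sumGℚ f ≡ sumGℚ (λ x → f (false ∷ x)) + sumGℚ (λ x → f (true ∷ x))
  sumG-split {n} f = trans (∑-++ (List.map (false ∷_) (allG n)) _ f)
                           (cong₂ _+_ (∑-map (false ∷_) (allG n) f) (∑-map (true ∷_) (allG n) f))

  sumG-translate : ∀ {n} (f : G n → ℚ) y → sumGℚ (λ x → f (x ⊕ y)) ≡ sumGℚ f
  sumG-translate {zero}  f []          = refl
  sumG-translate {suc n} f (false ∷ y) = begin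
    sumGℚ (λ x → f (x ⊕ (false ∷ y)))
      ≡⟨ sumG-split (λ x → f (x ⊕ (false ∷ y))) ⟩
    sumGℚ (λ x → f (false ∷ (x ⊕ y))) + sumGℚ (λ x → f (true ∷ (x ⊕ y)))
      ≡⟨ cong₂ _+_ (sumG-translate (λ x → f (false ∷ x)) y) (sumG-translate (λ x → f (true ∷ x)) y) ⟩
    sumGℚ (λ x → f (false ∷ x)) + sumGℚ (λ x → f (true ∷ x))
      ≡⟨ sumG-split f ⟨
    sumGℚ f ∎
    where open ≡-Reasoning
  sumG-translate {suc n} f (true ∷ y) = begin
    sumGℚ (λ x → f (x ⊕ (true ∷ y)))
      ≡⟨ sumG-split (λ x → f (x ⊕ (true ∷ y))) ⟩
    sumGℚ (λ x → f (true ∷ (x ⊕ y))) + sumGℚ (λ x → f (false ∷ (x ⊕ y)))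
      ≡⟨ cong₂ _+_ (sumG-translate (λ x → f (true ∷ x)) y) (sumG-translate (λ x → f (false ∷ x)) y) ⟩
    sumGℚ (λ x → f (true ∷ x)) + sumGℚ (λ x → f (false ∷ x))
      ≡⟨ ℚP.+-comm (sumGℚ (λ x → f (true ∷ x))) _ ⟩
    sumGℚ (λ x → f (false ∷ x)) + sumGℚ (λ x → f (true ∷ x))
      ≡⟨ sumG-split f ⟨
    sumGℚ f ∎
    where open ≡-Reasoning

  isZero : ∀ {n} → G n → Bool
  isZero []          = true
  isZero (true  ∷ _) = false
  isZero (false ∷ y) = isZero y

  pow2 : ℕ → ℚ
  pow2 zero    = 1ℚ
  pow2 (suc n) = pow2 n + pow2 n

  halfPow*pow2 : ∀ n → halfPow n * pow2 n ≡ 1ℚ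
  halfPow*pow2 zero    = refl
  halfPow*pow2 (suc n) = begin
    (½ * halfPow n) * (pow2 n + pow2 n)
      ≡⟨ ℚP.*-distribˡ-+ (½ * halfPow n) _ _ ⟩
    (½ * halfPow n) * pow2 n + (½ * halfPow n) * pow2 n
      ≡⟨ cong (λ z → z + z) (ℚP.*-assoc ½ (halfPow n) (pow2 n)) ⟩
    ½ * (halfPow n * pow2 n) + ½ * (halfPow n * pow2 n)
      ≡⟨ cong (λ z → ½ * z + ½ * z) (halfPow*pow2 n) ⟩
    ½ * 1ℚ + ½ * 1ℚ
      ≡⟨⟩
    1ℚ ∎
    where open ≡-Reasoning

  ∣halfPow∣ : ∀ n → ∣ halfPow n ∣ ≡ halfPow n
  ∣halfPow∣ zero    = refl
  ∣halfPow∣ (suc n) = trans (ℚP.∣p*q∣≡∣p∣*∣q∣ ½ (halfPow n)) (cong (½ *_) (∣halfPow∣ n))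

  sumG-χ : ∀ {n} (y : G n) → sumGℚ (λ b → χ b y) ≡ (if isZero y then pow2 n else 0ℚ)
  sumG-χ {zero}  []          = refl
  sumG-χ {suc n} (false ∷ y) = begin
    sumGℚ (λ b → χ b (false ∷ y))                      ≡⟨ sumG-split (λ b → χ b (false ∷ y)) ⟩
    sumGℚ (λ b → χ b y) + sumGℚ (λ b → χ b y)          ≡⟨ cong (λ z → z + z) (sumG-χ y) ⟩
    r + r                                              ≡⟨ double (isZero y) ⟩
    (if isZero y then pow2 (suc n) else 0ℚ)            ∎
    where
    open ≡-Reasoning
    r = if isZero y then pow2 n else 0ℚ
    double : ∀ z → (if z then pow2 n else 0ℚ) + (if z then pow2 n else 0ℚ) ≡
                   (if z then pow2 (suc n) else 0ℚ)
    double true  = refl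
    double false = refl
  sumG-χ {suc n} (true ∷ y) = begin
    sumGℚ (λ b → χ b (true ∷ y))              ≡⟨ sumG-split (λ b → χ b (true ∷ y)) ⟩
    S + sumGℚ (λ b → signOf (not (dot b y)))  ≡⟨ cong (S +_) (∑-cong (allG n) (λ b → signOf-not (dot b y))) ⟩
    S + sumGℚ (λ b → - χ b y)                 ≡⟨ cong (S +_) (∑-neg (allG n) (λ b → χ b y)) ⟩
    S + - S                                   ≡⟨ ℚP.+-inverseʳ S ⟩
    0ℚ                                        ∎
    where
    open ≡-Reasoning
    S = sumGℚ (λ b → χ b y)
    signOf-not : ∀ p → signOf (not p) ≡ - signOf p
    signOf-not true  = refl
    signOf-not false = refl

  sumG-isZero : ∀ {n} (g : G n → ℚ) c →
                sumGℚ (λ y → g y * (if isZero y then c else 0ℚ)) ≡ g (0G n) * c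
  sumG-isZero {zero}  g c = ℚP.+-identityʳ _
  sumG-isZero {suc n} g c = begin
    sumGℚ (λ y → g y * (if isZero y then c else 0ℚ))
      ≡⟨ sumG-split (λ y → g y * (if isZero y then c else 0ℚ)) ⟩
    sumGℚ (λ y → g (false ∷ y) * (if isZero y then c else 0ℚ)) + sumGℚ (λ y → g (true ∷ y) * 0ℚ)
      ≡⟨ cong₂ _+_ (sumG-isZero (λ y → g (false ∷ y)) c)
                   (trans (∑-cong (allG n) (λ y → ℚP.*-zeroʳ (g (true ∷ y)))) (∑-zero (allG n))) ⟩
    g (0G (suc n)) * c + 0ℚ
      ≡⟨ ℚP.+-identityʳ _ ⟩
    g (0G (suc n)) * c ∎
    where open ≡-Reasoning

  ∣signOf∣ : ∀ d → ∣ signOf d ∣ ≡ 1ℚ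
  ∣signOf∣ true  = refl
  ∣signOf∣ false = refl

  ∣⟦⟧∣ : ∀ s → ∣ ⟦ s ⟧ ∣ ≡ 1ℚ
  ∣⟦⟧∣ Sign.- = refl
  ∣⟦⟧∣ Sign.+ = refl

  p≡-p⇒0≤p : ∀ {p} → p ≡ - p → 0ℚ ≤ℚ p
  p≡-p⇒0≤p {p} p≡-p with ℚP.≤-total p 0ℚ
  ... | inj₁ p≤0 = subst (0ℚ ≤ℚ_) (sym p≡-p) (ℚP.neg-antimono-≤ p≤0)
  ... | inj₂ 0≤p = 0≤p

  open CommutativeSemigroupProperties (CommutativeRing.*-commutativeSemigroup ℚP.+-*-commutativeRing)
    using (x∙yz≈y∙xz; x∙yz≈z∙xy)

  charSum : ∀ {n} → Subset n → G n → ℚ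
  charSum W b = sumGℚ (λ y → 𝟙ℚ W y * χ b y)

  -- Either χ_b ≡ 1 on W and every term is non-negative, or some y₀ ∈ W has χ_b(y₀) = -1 and
  -- translating by y₀ negates the sum.
  charSum-nonneg : ∀ {n} {W : Subset n} → IsSubgroup W → ∀ b → 0ℚ ≤ℚ charSum W b
  charSum-nonneg {n} {W} W-subgroup b with search (λ y → W y ∧ dot b y)
  ... | inj₂ χ≡1-on-W = ∑-nonneg (allG n) (λ y → term-nonneg (W y) (dot b y) (χ≡1-on-W y))
    where
    term-nonneg : ∀ w d → w ∧ d ≡ false → 0ℚ ≤ℚ ind w * signOf d
    term-nonneg true  false _ = ℚP.nonNegative⁻¹ 1ℚ
    term-nonneg false true  _ = ℚP.≤-refl
    term-nonneg false false _ = ℚP.≤-refl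
  ... | inj₁ (y₀ , y₀∈W∩χ≡-1) = p≡-p⇒0≤p (begin
    charSum W b
      ≡⟨ sumG-translate (λ y → 𝟙ℚ W y * χ b y) y₀ ⟨
    sumGℚ (λ y → 𝟙ℚ W (y ⊕ y₀) * χ b (y ⊕ y₀))
      ≡⟨ ∑-cong (allG n) (λ y → cong₂ (λ w d → ind w * signOf d)
           (subgroup-translate W-subgroup (∧-conicalˡ _ _ y₀∈W∩χ≡-1) y)
           (trans (dot-distribˡ-⊕ b y y₀) (cong (dot b y xor_) (∧-conicalʳ _ _ y₀∈W∩χ≡-1)))) ⟩
    sumGℚ (λ y → 𝟙ℚ W y * signOf (dot b y xor true))
      ≡⟨ ∑-cong (allG n) (λ y → term-flip (W y) (dot b y)) ⟩
    sumGℚ (λ y → - (𝟙ℚ W y * χ b y))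
      ≡⟨ ∑-neg (allG n) (λ y → 𝟙ℚ W y * χ b y) ⟩
    - charSum W b ∎)
    where
    open ≡-Reasoning
    term-flip : ∀ w d → ind w * signOf (d xor true) ≡ - (ind w * signOf d)
    term-flip true  true  = refl
    term-flip true  false = refl
    term-flip false true  = refl
    term-flip false false = refl

  sumG-charSum : ∀ {n} {W : Subset n} → W (0G n) ≡ true → sumGℚ (charSum W) ≡ pow2 n
  sumG-charSum {n} {W} 0∈W = begin
    sumGℚ (λ b → sumGℚ (λ y → 𝟙ℚ W y * χ b y))
      ≡⟨ ∑-comm (allG n) (allG n) (λ b y → 𝟙ℚ W y * χ b y) ⟩
    sumGℚ (λ y → sumGℚ (λ b → 𝟙ℚ W y * χ b y))
      ≡⟨ ∑-cong (allG n) (λ y → ∑-*ˡ (allG n) (𝟙ℚ W y) (λ b → χ b y)) ⟩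
    sumGℚ (λ y → 𝟙ℚ W y * sumGℚ (λ b → χ b y))
      ≡⟨ ∑-cong (allG n) (λ y → cong (𝟙ℚ W y *_) (sumG-χ y)) ⟩
    sumGℚ (λ y → 𝟙ℚ W y * (if isZero y then pow2 n else 0ℚ))
      ≡⟨ sumG-isZero (𝟙ℚ W) (pow2 n) ⟩
    𝟙ℚ W (0G n) * pow2 n
      ≡⟨ cong (λ w → ind w * pow2 n) 0∈W ⟩
    1ℚ * pow2 n
      ≡⟨ ℚP.*-identityˡ (pow2 n) ⟩
    pow2 n ∎
    where open ≡-Reasoning

  fourier-coset : ∀ {n} (W : Subset n) a b →
                  fourier (𝟙ℚ (cosetOf W a)) b ≡ halfPow n * (χ b a * charSum W b)
  fourier-coset {n} W a b = cong (halfPow n *_) (begin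
    sumGℚ (λ x → 𝟙ℚ W (x ⊕ a) * χ b x)
      ≡⟨ sumG-translate (λ x → 𝟙ℚ W (x ⊕ a) * χ b x) a ⟨
    sumGℚ (λ y → 𝟙ℚ W ((y ⊕ a) ⊕ a) * χ b (y ⊕ a))
      ≡⟨ ∑-cong (allG n) (λ y → cong₂ _*_ (cong (𝟙ℚ W) (⊕-cancelʳ y a)) (χ-⊕ b y a)) ⟩
    sumGℚ (λ y → 𝟙ℚ W y * (χ b y * χ b a))
      ≡⟨ ∑-cong (allG n) (λ y → x∙yz≈z∙xy (𝟙ℚ W y) (χ b y) (χ b a)) ⟩
    sumGℚ (λ y → χ b a * (𝟙ℚ W y * χ b y))
      ≡⟨ ∑-*ˡ (allG n) (χ b a) (λ y → 𝟙ℚ W y * χ b y) ⟩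
    χ b a * charSum W b ∎)
    where open ≡-Reasoning

  ∣fourier-coset∣ : ∀ {n} {W : Subset n} → IsSubgroup W → ∀ a b →
                    ∣ fourier (𝟙ℚ (cosetOf W a)) b ∣ ≡ halfPow n * charSum W b
  ∣fourier-coset∣ {n} {W} W-subgroup a b = begin
    ∣ fourier (𝟙ℚ (cosetOf W a)) b ∣
      ≡⟨ cong ∣_∣ (fourier-coset W a b) ⟩
    ∣ halfPow n * (χ b a * charSum W b) ∣
      ≡⟨ ℚP.∣p*q∣≡∣p∣*∣q∣ (halfPow n) _ ⟩
    ∣ halfPow n ∣ * ∣ χ b a * charSum W b ∣
      ≡⟨ cong₂ _*_ (∣halfPow∣ n) (ℚP.∣p*q∣≡∣p∣*∣q∣ (χ b a) _) ⟩
    halfPow n * (∣ χ b a ∣ * ∣ charSum W b ∣)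
      ≡⟨ cong (halfPow n *_) (cong₂ _*_ (∣signOf∣ (dot b a)) (ℚP.0≤p⇒∣p∣≡p (charSum-nonneg W-subgroup b))) ⟩
    halfPow n * (1ℚ * charSum W b)
      ≡⟨ cong (halfPow n *_) (ℚP.*-identityˡ _) ⟩
    halfPow n * charSum W b ∎
    where open ≡-Reasoning

  algNorm-coset : ∀ {n} {W : Subset n} → IsSubgroup W → ∀ a → algNorm (𝟙ℚ (cosetOf W a)) ≡ 1ℚ
  algNorm-coset {n} {W} W-subgroup a = begin
    sumGℚ (λ b → ∣ fourier (𝟙ℚ (cosetOf W a)) b ∣)
      ≡⟨ ∑-cong (allG n) (∣fourier-coset∣ W-subgroup a) ⟩
    sumGℚ (λ b → halfPow n * charSum W b)
      ≡⟨ ∑-*ˡ (allG n) (halfPow n) (charSum W) ⟩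
    halfPow n * sumGℚ (charSum W)
      ≡⟨ cong (halfPow n *_) (sumG-charSum {W = W} (proj₁ W-subgroup)) ⟩
    halfPow n * pow2 n
      ≡⟨ halfPow*pow2 n ⟩
    1ℚ ∎
    where open ≡-Reasoning

  module _ {n : ℕ} where

    fourier-cong : ∀ {f g : G n → ℚ} → (∀ x → f x ≡ g x) → ∀ b → fourier f b ≡ fourier g b
    fourier-cong f≗g b = cong (halfPow n *_) (∑-cong (allG n) (λ x → cong (_* χ b x) (f≗g x)))

    algNorm-cong : ∀ {f g : G n → ℚ} → (∀ x → f x ≡ g x) → algNorm f ≡ algNorm g
    algNorm-cong f≗g = ∑-cong (allG n) (λ b → cong ∣_∣ (fourier-cong f≗g b))

    fourier-∑ : ∀ {A : Set} (ts : List A) (F : A → G n → ℚ) b →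
                fourier (λ x → ∑ ts (λ t → F t x)) b ≡ ∑ ts (λ t → fourier (F t) b)
    fourier-∑ ts F b = begin
      halfPow n * sumGℚ (λ x → ∑ ts (λ t → F t x) * χ b x)
        ≡⟨ cong (halfPow n *_) (∑-cong (allG n) (λ x → ∑-*ʳ ts (χ b x) (λ t → F t x))) ⟨
      halfPow n * sumGℚ (λ x → ∑ ts (λ t → F t x * χ b x))
        ≡⟨ cong (halfPow n *_) (∑-comm (allG n) ts (λ x t → F t x * χ b x)) ⟩
      halfPow n * ∑ ts (λ t → sumGℚ (λ x → F t x * χ b x))
        ≡⟨ ∑-*ˡ ts (halfPow n) (λ t → sumGℚ (λ x → F t x * χ b x)) ⟨
      ∑ ts (λ t → fourier (F t) b) ∎
      where open ≡-Reasoning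

    fourier-*ˡ : ∀ c (f : G n → ℚ) b → fourier (λ x → c * f x) b ≡ c * fourier f b
    fourier-*ˡ c f b = begin
      halfPow n * sumGℚ (λ x → (c * f x) * χ b x)
        ≡⟨ cong (halfPow n *_) (∑-cong (allG n) (λ x → ℚP.*-assoc c (f x) (χ b x))) ⟩
      halfPow n * sumGℚ (λ x → c * (f x * χ b x))
        ≡⟨ cong (halfPow n *_) (∑-*ˡ (allG n) c (λ x → f x * χ b x)) ⟩
      halfPow n * (c * sumGℚ (λ x → f x * χ b x))
        ≡⟨ x∙yz≈y∙xz (halfPow n) c _ ⟩
      c * fourier f b ∎
      where open ≡-Reasoning

    algNorm-∑-≤ : ∀ {A : Set} (ts : List A) (F : A → G n → ℚ) →
                  algNorm (λ x → ∑ ts (λ t → F t x)) ≤ℚ ∑ ts (λ t → algNorm (F t))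
    algNorm-∑-≤ ts F = begin
      sumGℚ (λ b → ∣ fourier (λ x → ∑ ts (λ t → F t x)) b ∣)
        ≡⟨ ∑-cong (allG n) (λ b → cong ∣_∣ (fourier-∑ ts F b)) ⟩
      sumGℚ (λ b → ∣ ∑ ts (λ t → fourier (F t) b) ∣)
        ≤⟨ ∑-mono-≤ (allG n) (λ b → ∣∑∣≤∑∣∣ ts (λ t → fourier (F t) b)) ⟩
      sumGℚ (λ b → ∑ ts (λ t → ∣ fourier (F t) b ∣))
        ≡⟨ ∑-comm (allG n) ts (λ b t → ∣ fourier (F t) b ∣) ⟩
      ∑ ts (λ t → algNorm (F t)) ∎
      where open ℚP.≤-Reasoning

    algNorm-*ˡ : ∀ c (f : G n → ℚ) → algNorm (λ x → c * f x) ≡ ∣ c ∣ * algNorm f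
    algNorm-*ˡ c f = begin
      sumGℚ (λ b → ∣ fourier (λ x → c * f x) b ∣)
        ≡⟨ ∑-cong (allG n) (λ b →
             trans (cong ∣_∣ (fourier-*ˡ c f b)) (ℚP.∣p*q∣≡∣p∣*∣q∣ c (fourier f b))) ⟩
      sumGℚ (λ b → ∣ c ∣ * ∣ fourier f b ∣)
        ≡⟨ ∑-*ˡ (allG n) ∣ c ∣ (λ b → ∣ fourier f b ∣) ⟩
      ∣ c ∣ * algNorm f ∎
      where open ≡-Reasoning

    algNorm-signedIndicator : ∀ (t : Sign × Coset n) → algNorm (signedIndicator t) ≡ 1ℚ
    algNorm-signedIndicator (s , C) = begin
      algNorm (λ x → ⟦ s ⟧ * 𝟙ℚ (members C) x)
        ≡⟨ algNorm-*ˡ ⟦ s ⟧ (𝟙ℚ (members C)) ⟩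
      ∣ ⟦ s ⟧ ∣ * algNorm (𝟙ℚ (members C))
        ≡⟨ cong₂ _*_ (∣⟦⟧∣ s) (algNorm-coset (isSubgroup C) (base C)) ⟩
      1ℚ * 1ℚ
        ≡⟨⟩
      1ℚ ∎
      where open ≡-Reasoning

    algNorm-signedSum-≤ : ∀ (ts : SignedCosets n) → algNorm (signedSum ts) ≤ℚ ∑ ts (λ _ → 1ℚ)
    algNorm-signedSum-≤ ts =
      ℚP.≤-trans (algNorm-∑-≤ ts signedIndicator) (ℚP.≤-reflexive (∑-cong ts algNorm-signedIndicator))

evalBool : ∀ {ℓ} → SetExpr ℓ → Vec Bool ℓ → Bool
evalBool whole       v = true
evalBool (gen i)     v = lookup v i
evalBool (compl e)   v = not' (evalBool e v)
evalBool (union e f) v = evalBool e v ∨' evalBool f v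
evalBool (inter e f) v = evalBool e v ∧ evalBool f v

evalExpr-tabulate : ∀ {n ℓ} (C : Fin ℓ → Subset n) e x →
                    evalExpr C e x ≡ evalBool e (tabulate (λ i → C i x))
evalExpr-tabulate C whole       x = refl
evalExpr-tabulate C (gen i)     x = sym (lookup∘tabulate (λ i → C i x) i)
evalExpr-tabulate C (compl e)   x = cong not' (evalExpr-tabulate C e x)
evalExpr-tabulate C (union e f) x = cong₂ _∨'_ (evalExpr-tabulate C e x) (evalExpr-tabulate C f x)
evalExpr-tabulate C (inter e f) x = cong₂ _∧_ (evalExpr-tabulate C e x) (evalExpr-tabulate C f x)

toCoset : ∀ {n} {S : Subset n} → IsCoset S → Coset n
toCoset (W , a , W-subgroup , _) = record { subgroup = W ; base = a ; isSubgroup = W-subgroup }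

toCoset-members : ∀ {n} {S : Subset n} (S-coset : IsCoset S) x → S x ≡ members (toCoset S-coset) x
toCoset-members (_ , _ , _ , S≗W+a) = S≗W+a

cosetComplexity⇒booleanCombination :
  ∀ {n ℓ} {A : Subset n} → CosetComplexityAtMost ℓ A →
  Σ (Fin ℓ → Coset n) λ Cs → Σ (Vec Bool ℓ → Bool) λ f →
    ∀ x → A x ≡ f (tabulate (λ i → members (Cs i) x))
cosetComplexity⇒booleanCombination {A = A} (C , C-cosets , e , A≗e) =
  (λ i → toCoset (C-cosets i)) , evalBool e , λ x → begin
    A x
      ≡⟨ A≗e x ⟩
    evalExpr C e x
      ≡⟨ evalExpr-tabulate C e x ⟩
    evalBool e (tabulate (λ i → C i x))
      ≡⟨ cong (evalBool e) (tabulate-cong (λ i → toCoset-members (C-cosets i) x)) ⟩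
    evalBool e (tabulate (λ i → members (toCoset (C-cosets i)) x)) ∎
  where open ≡-Reasoning

sumFinℤ-lookup : ∀ {A : Set} (xs : List A) (g : A → ℤ.ℤ) →
                 sumFinℤ (λ i → g (List.lookup xs i)) ≡ ℤΣ.∑ xs g
sumFinℤ-lookup []       g = refl
sumFinℤ-lookup (x ∷ xs) g = cong (ℤ._+_ (g x)) (sumFinℤ-lookup xs g)

⟦⟧≡±1 : ∀ s → (ℤΣ.⟦ s ⟧ ≡ ℤ.1ℤ) ⊎ (ℤΣ.⟦ s ⟧ ≡ ℤ.-1ℤ)
⟦⟧≡±1 Sign.+ = inj₁ refl
⟦⟧≡±1 Sign.- = inj₂ refl

open AlgebraNorm using (algNorm-cong; algNorm-signedSum-≤; ∑-ones-≤)

open import Data.Nat using (ℕ; _≤_; _^_)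
open import Data.Fin using (Fin)
open import Data.Integer using (ℤ; _*_; -1ℤ; 1ℤ; +_)
open import Data.Rational using (ℚ) renaming (_≤_ to _≤ℚ_)
open import Data.Rational as Q using ()
open import Data.Product using (Σ; _×_)
open import Data.Sum using (_⊎_)
open import Relation.Binary.PropositionalEquality using (_≡_)

lemma2p1 : (n ℓ : ℕ) (A : Subset n) → CosetComplexityAtMost ℓ A →
    (Σ ℕ λ t → (t ≤ 3 ^ ℓ) ×
      Σ (Fin t → Subset n) λ W → Σ (Fin t → G n) λ a → Σ (Fin t → ℤ) λ ε →
        (∀ i → IsSubgroup (W i)) ×
        (∀ i → (ε i ≡ 1ℤ) ⊎ (ε i ≡ -1ℤ)) ×
        (∀ x → 𝟙ℤ A x ≡ sumFinℤ (λ i → ε i * 𝟙ℤ (cosetOf (W i) (a i)) x)))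
    × (algNorm (𝟙ℚ A) ≤ℚ ((+ (3 ^ ℓ)) Q./ 1))
lemma2p1 n ℓ A A-complexity with cosetComplexity⇒booleanCombination A-complexity
... | Cs , f , A≗f =
  (length ts , decompose-length Cs f ,
   (λ i → subgroup (coset i)) , (λ i → base (coset i)) , (λ i → ℤΣ.⟦ sign i ⟧) ,
   (λ i → isSubgroup (coset i)) , (λ i → ⟦⟧≡±1 (sign i)) , 𝟙ℤA≡signedSum) ,
  (begin
    algNorm (𝟙ℚ A)            ≡⟨ algNorm-cong 𝟙ℚA≡signedSum ⟩
    algNorm (ℚΣ.signedSum ts) ≤⟨ algNorm-signedSum-≤ ts ⟩
    ℚΣ.∑ ts (λ _ → Q.1ℚ)      ≤⟨ ∑-ones-≤ ts (decompose-length Cs f) ⟩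
    + (3 ^ ℓ) Q./ 1           ∎)
  where
  open ℚP.≤-Reasoning
  ts = decompose Cs f
  sign = λ i → proj₁ (List.lookup ts i)
  coset = λ i → proj₂ (List.lookup ts i)
  𝟙ℚA≡signedSum : ∀ x → 𝟙ℚ A x ≡ ℚΣ.signedSum ts x
  𝟙ℚA≡signedSum x = trans (cong ℚΣ.ind (A≗f x)) (ℚΣ.decompose-signedSum Cs f x)
  𝟙ℤA≡signedSum : ∀ x → 𝟙ℤ A x ≡ sumFinℤ (λ i → ℤΣ.signedIndicator (List.lookup ts i) x)
  𝟙ℤA≡signedSum x = trans (cong ℤΣ.ind (A≗f x))
    (trans (ℤΣ.decompose-signedSum Cs f x) (sym (sumFinℤ-lookup ts (λ t → ℤΣ.signedIndicator t x))))
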